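{- Let $(\mathcal{T}_r)_{r\in\mathbb{Z}}$ be a sequence of complex numbers satisfying $\mathcal{T}_r=\mathcal{T}_{r-1}+\mathcal{T}_{r-2}+\mathcal{T}_{r-3}$ for all integers $r$. Then for every non-negative integer $k$: \[ \begin{aligned} 8\sum_{j=0}^k (-1)^j\mathcal{T}_j^2 &= 7(\mathcal{T}_{ -1}^2+(-1)^k\mathcal{T}_k^2) - 5(\mathcal{T}_{ -2}^2+(-1)^k\mathcal{T}_{k-1}^2) + 8(\mathcal{T}_{ -3}^2+(-1)^k\mathcal{T}_{k-2}^2)\\ &\quad - 2(\mathcal{T}_{ -4}^2+(-1)^k\mathcal{T}_{k-3}^2) + (\mathcal{T}_{ -5}^2+(-1)^k\mathcal{T}_{k-4}^2) - (\mathcal{T}_{ -6}^2+(-1)^k\mathcal{T}_{k-5}^2). \end{aligned} \]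
   Context: A generalized Tribonacci sequence is determined by arbitrary initial values $\mathcal{T}_0,\mathcal{T}_1,\mathcal{T}_2$ and the recurrence $\mathcal{T}_r=\mathcal{T}_{r-1}+\mathcal{T}_{r-2}+\mathcal{T}_{r-3}$, extended to all integer indices. -}

module Defs where

open import Algebra.Bundles using (CommutativeRing)
open import Data.Nat using (ℕ; zero; suc)
open import Data.Integer using (ℤ; +_) renaming (_-_ to _-ℤ_)

module _ {c ℓ} (R : CommutativeRing c ℓ) where
  open CommutativeRing R hiding (zero)

  sq : Carrier → Carrier
  sq x = x * x

  sgn : ℕ → Carrier
  sgn zero = 1#
  sgn (suc n) = - sgn n

  nmul : ℕ → Carrier → Carrier
  nmul zero x = 0#
  nmul (suc n) x = x + nmul n x

  altSqSum : (ℤ → Carrier) → ℕ → Carrier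
  altSqSum T zero = sgn zero * sq (T (+ 0))
  altSqSum T (suc k) = altSqSum T k + sgn (suc k) * sq (T (+ suc k))

  IsTribonacci : (ℤ → Carrier) → Set ℓ
  IsTribonacci T = ∀ r → T r ≈ T (r -ℤ + 1) + T (r -ℤ + 2) + T (r -ℤ + 3)

-- Put Φ(r) = 7T_r² − 5T_{r−1}² + 8T_{r−2}² − 2T_{r−3}² + T_{r−4}² − T_{r−5}²
-- (boundary T r).
-- For every r one has 8T_r² = Φ(r) + Φ(r−1): after expressing T_r, …, T_{r−3}
-- through T_{r−4}, T_{r−5}, T_{r−6} by the recurrence this is a polynomial
-- identity in three variables. Hence the alternating sum of the 8T_j²
-- telescopes to Φ(−1) + (−1)^k Φ(k), and Φ is linear in the squares, which
-- regroups this into the stated right-hand side.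
module Submission where

open import Defs
open import Algebra.Bundles using (CommutativeRing)
open import Data.Nat using (ℕ)
open import Data.Integer using (ℤ; +_; -[1+_]) renaming (_-_ to _-ℤ_)

import Data.Nat as ℕ
import Data.Nat.Properties as ℕ
import Data.Integer as ℤ
import Data.Integer.Properties as ℤ
open import Data.Maybe using (Maybe; just; nothing)
open import Relation.Nullary using (yes; no)
open import Relation.Binary.PropositionalEquality as ≡ using (_≡_)
open import Algebra.Solver.Ring.AlmostCommutativeRing
  using (_-Raw-AlmostCommutative⟶_; fromCommutativeRing)
import Algebra.Properties.Ring as RingProperties
import Algebra.Properties.Semiring.Mult as SemiringMult
import Algebra.Properties.CommutativeMonoid.Mult as CommutativeMonoidMult
import Algebra.Solver.Ring as RingSolver
import Relation.Binary.Reasoning.Setoid as SetoidReasoning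

-- The canonical map ℤ → R makes ℤ a coefficient ring for Algebra.Solver.Ring;
-- the natural-coefficient solver cannot handle subtraction.
module IntegerCoefficients {c ℓ} (R : CommutativeRing c ℓ) where
  open CommutativeRing R
  open RingProperties ring
  open SemiringMult semiring using (_×_; ×-homo-+; ×1-homo-*)
  open SetoidReasoning setoid

  fromℤ : ℤ → Carrier
  fromℤ (+ n)    = n × 1#
  fromℤ -[1+ n ] = - (ℕ.suc n × 1#)

  +-cancelˡ-minus : ∀ u x y → (u + x) - (u + y) ≈ x - y
  +-cancelˡ-minus u x y = begin
    (u + x) + - (u + y)   ≈⟨ +-congˡ (sym (-‿+-comm u y)) ⟩
    (u + x) + (- u + - y) ≈⟨ +-assoc u x (- u + - y) ⟩
    u + (x + (- u + - y)) ≈⟨ +-congˡ (sym (+-assoc x (- u) (- y))) ⟩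
    u + ((x + - u) + - y) ≈⟨ +-congˡ (+-congʳ (+-comm x (- u))) ⟩
    u + ((- u + x) + - y) ≈⟨ +-congˡ (+-assoc (- u) x (- y)) ⟩
    u + (- u + (x + - y)) ≈⟨ sym (+-assoc u (- u) (x + - y)) ⟩
    (u + - u) + (x + - y) ≈⟨ +-congʳ (-‿inverseʳ u) ⟩
    0# + (x + - y)        ≈⟨ +-identityˡ _ ⟩
    x + - y               ∎

  fromℤ-⊖ : ∀ m n → fromℤ (m ℤ.⊖ n) ≈ m × 1# - n × 1#
  fromℤ-⊖ ℕ.zero    ℕ.zero    = sym (trans (+-congˡ -0#≈0#) (+-identityʳ 0#))
  fromℤ-⊖ (ℕ.suc m) ℕ.zero    = sym (trans (+-congˡ -0#≈0#) (+-identityʳ _))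
  fromℤ-⊖ ℕ.zero    (ℕ.suc n) = sym (+-identityˡ _)
  fromℤ-⊖ (ℕ.suc m) (ℕ.suc n) = begin
    fromℤ (ℕ.suc m ℤ.⊖ ℕ.suc n)     ≡⟨ ≡.cong fromℤ (ℤ.[1+m]⊖[1+n]≡m⊖n m n) ⟩
    fromℤ (m ℤ.⊖ n)                 ≈⟨ fromℤ-⊖ m n ⟩
    m × 1# - n × 1#                 ≈⟨ sym (+-cancelˡ-minus 1# _ _) ⟩
    (1# + m × 1#) - (1# + n × 1#)   ∎

  fromℤ-neg : ∀ i → fromℤ (ℤ.- i) ≈ - fromℤ i
  fromℤ-neg (+ ℕ.zero)  = sym -0#≈0#
  fromℤ-neg (+ ℕ.suc n) = refl
  fromℤ-neg -[1+ n ]    = sym (-‿involutive _)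

  fromℤ-+ : ∀ i j → fromℤ (i ℤ.+ j) ≈ fromℤ i + fromℤ j
  fromℤ-+ -[1+ m ] -[1+ n ] = begin
    - (ℕ.suc (ℕ.suc (m ℕ.+ n)) × 1#)      ≡⟨ ≡.cong (λ z → - (ℕ.suc z × 1#)) (≡.sym (ℕ.+-suc m n)) ⟩
    - ((ℕ.suc m ℕ.+ ℕ.suc n) × 1#)        ≈⟨ -‿cong (×-homo-+ 1# (ℕ.suc m) (ℕ.suc n)) ⟩
    - (ℕ.suc m × 1# + ℕ.suc n × 1#)       ≈⟨ sym (-‿+-comm _ _) ⟩
    - (ℕ.suc m × 1#) + - (ℕ.suc n × 1#)   ∎
  fromℤ-+ -[1+ m ] (+ n)    = trans (fromℤ-⊖ n (ℕ.suc m)) (+-comm _ _)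
  fromℤ-+ (+ m)    -[1+ n ] = fromℤ-⊖ m (ℕ.suc n)
  fromℤ-+ (+ m)    (+ n)    = ×-homo-+ 1# m n

  fromℤ-*-pos : ∀ m j → fromℤ (+ m ℤ.* j) ≈ fromℤ (+ m) * fromℤ j
  fromℤ-*-pos m (+ n) = begin
    fromℤ (+ m ℤ.* + n)       ≡⟨ ≡.cong fromℤ (≡.sym (ℤ.pos-* m n)) ⟩
    (m ℕ.* n) × 1#            ≈⟨ ×1-homo-* m n ⟩
    fromℤ (+ m) * fromℤ (+ n) ∎
  fromℤ-*-pos m -[1+ n ] = begin
    fromℤ (+ m ℤ.* -[1+ n ])              ≡⟨ ≡.cong fromℤ (≡.sym (ℤ.neg-distribʳ-* (+ m) (+ ℕ.suc n))) ⟩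
    fromℤ (ℤ.- (+ m ℤ.* + ℕ.suc n))       ≈⟨ fromℤ-neg (+ m ℤ.* + ℕ.suc n) ⟩
    - fromℤ (+ m ℤ.* + ℕ.suc n)           ≈⟨ -‿cong (fromℤ-*-pos m (+ ℕ.suc n)) ⟩
    - (fromℤ (+ m) * fromℤ (+ ℕ.suc n))   ≈⟨ -‿distribʳ-* _ _ ⟩
    fromℤ (+ m) * fromℤ -[1+ n ]          ∎

  fromℤ-* : ∀ i j → fromℤ (i ℤ.* j) ≈ fromℤ i * fromℤ j
  fromℤ-* (+ m)    j = fromℤ-*-pos m j
  fromℤ-* -[1+ m ] j = begin
    fromℤ (-[1+ m ] ℤ.* j)              ≡⟨ ≡.cong fromℤ (≡.sym (ℤ.neg-distribˡ-* (+ ℕ.suc m) j)) ⟩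
    fromℤ (ℤ.- (+ ℕ.suc m ℤ.* j))       ≈⟨ fromℤ-neg (+ ℕ.suc m ℤ.* j) ⟩
    - fromℤ (+ ℕ.suc m ℤ.* j)           ≈⟨ -‿cong (fromℤ-*-pos (ℕ.suc m) j) ⟩
    - (fromℤ (+ ℕ.suc m) * fromℤ j)     ≈⟨ -‿distribˡ-* _ _ ⟩
    fromℤ -[1+ m ] * fromℤ j            ∎

  fromℤ-homomorphism : ℤ.+-*-rawRing -Raw-AlmostCommutative⟶ fromCommutativeRing R
  fromℤ-homomorphism = record
    { ⟦_⟧    = fromℤ
    ; +-homo = fromℤ-+
    ; *-homo = fromℤ-*
    ; -‿homo = fromℤ-neg
    ; 0-homo = refl
    ; 1-homo = +-identityʳ 1#
    }

  fromℤ-≟ : ∀ i j → Maybe (fromℤ i ≈ fromℤ j)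
  fromℤ-≟ i j with i ℤ.≟ j
  ... | yes i≡j = just (reflexive (≡.cong fromℤ i≡j))
  ... | no _    = nothing

  open RingSolver ℤ.+-*-rawRing (fromCommutativeRing R) fromℤ-homomorphism fromℤ-≟ public

i-m-n≡i-[m+n] : ∀ i m n → i -ℤ + m -ℤ + n ≡ i -ℤ + (m ℕ.+ n)
i-m-n≡i-[m+n] i m n = begin
  i -ℤ + m -ℤ + n                   ≡⟨ ℤ.+-assoc i (ℤ.- + m) (ℤ.- + n) ⟩
  i ℤ.+ (ℤ.- + m ℤ.+ ℤ.- + n)       ≡⟨ ≡.cong (λ j → i ℤ.+ j) (≡.sym (ℤ.neg-distrib-+ (+ m) (+ n))) ⟩
  i ℤ.+ ℤ.- (+ m ℤ.+ + n)           ≡⟨ ≡.cong (λ j → i ℤ.+ ℤ.- j) (≡.sym (ℤ.pos-+ m n)) ⟩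
  i -ℤ + (m ℕ.+ n)                  ∎
  where open ≡.≡-Reasoning

module _ {c ℓ} (R : CommutativeRing c ℓ) where
  open CommutativeRing R
  open SemiringMult semiring using (_×_; ×-congʳ; ×-comm-*)
  open CommutativeMonoidMult +-commutativeMonoid using (×-distrib-+)
  open IntegerCoefficients R using (Polynomial; solve; _:=_; _:+_; _:-_; _:*_; _:×_; :-_)
  open SetoidReasoning setoid

  -- For a numeral n, n × x agrees definitionally with nmul R n x, so the
  -- statements below match mainTheorem4 without conversion.
  boundaryForm : Carrier → Carrier → Carrier → Carrier → Carrier → Carrier → Carrier
  boundaryForm u₀ u₁ u₂ u₃ u₄ u₅ = ((((7 × u₀ - 5 × u₁) + 8 × u₂) - 2 × u₃) + u₄) - u₅

  :boundaryForm : ∀ {n} → (u₀ u₁ u₂ u₃ u₄ u₅ : Polynomial n) → Polynomial n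
  :boundaryForm u₀ u₁ u₂ u₃ u₄ u₅ = ((((7 :× u₀ :- 5 :× u₁) :+ 8 :× u₂) :- 2 :× u₃) :+ u₄) :- u₅

  boundaryForm-cong : ∀ {u₀ u₁ u₂ u₃ u₄ u₅ v₀ v₁ v₂ v₃ v₄ v₅} →
    u₀ ≈ v₀ → u₁ ≈ v₁ → u₂ ≈ v₂ → u₃ ≈ v₃ → u₄ ≈ v₄ → u₅ ≈ v₅ →
    boundaryForm u₀ u₁ u₂ u₃ u₄ u₅ ≈ boundaryForm v₀ v₁ v₂ v₃ v₄ v₅
  boundaryForm-cong p₀ p₁ p₂ p₃ p₄ p₅ =
    +-cong (+-cong (+-cong (+-cong (+-cong (×-congʳ 7 p₀) (-‿cong (×-congʳ 5 p₁)))
      (×-congʳ 8 p₂)) (-‿cong (×-congʳ 2 p₃))) p₄) (-‿cong p₅)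

  boundaryForm-linear : ∀ s x₀ x₁ x₂ x₃ x₄ x₅ y₀ y₁ y₂ y₃ y₄ y₅ →
    boundaryForm x₀ x₁ x₂ x₃ x₄ x₅ + s * boundaryForm y₀ y₁ y₂ y₃ y₄ y₅ ≈
      boundaryForm (x₀ + s * y₀) (x₁ + s * y₁) (x₂ + s * y₂) (x₃ + s * y₃) (x₄ + s * y₄) (x₅ + s * y₅)
  boundaryForm-linear = solve 13 (λ s x₀ x₁ x₂ x₃ x₄ x₅ y₀ y₁ y₂ y₃ y₄ y₅ →
    :boundaryForm x₀ x₁ x₂ x₃ x₄ x₅ :+ s :* :boundaryForm y₀ y₁ y₂ y₃ y₄ y₅ :=
      :boundaryForm (x₀ :+ s :* y₀) (x₁ :+ s :* y₁) (x₂ :+ s :* y₂) (x₃ :+ s :* y₃) (x₄ :+ s :* y₄) (x₅ :+ s :* y₅)) refl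

  sq-cong : ∀ {x y} → x ≈ y → sq R x ≈ sq R y
  sq-cong x≈y = *-cong x≈y x≈y

  8×sq≈boundaryForm-sum : ∀ {a b c d e f g} →
    a ≈ b + c + d → b ≈ c + d + e → c ≈ d + e + f → d ≈ e + f + g →
    8 × sq R a ≈ boundaryForm (sq R a) (sq R b) (sq R c) (sq R d) (sq R e) (sq R f)
               + boundaryForm (sq R b) (sq R c) (sq R d) (sq R e) (sq R f) (sq R g)
  8×sq≈boundaryForm-sum {a} {b} {c} {d} {e} {f} {g} a≈ b≈ c≈ d≈ =
    trans (×-congʳ 8 (sq-cong a≈a′))
      (trans polynomial-identity
        (sym (+-cong (boundaryForm-cong (sq-cong a≈a′) (sq-cong b≈b′) (sq-cong c≈c′) (sq-cong d≈) refl refl)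
                     (boundaryForm-cong (sq-cong b≈b′) (sq-cong c≈c′) (sq-cong d≈) refl refl refl))))
    where
    d′ c′ b′ a′ : Carrier
    d′ = e + f + g
    c′ = d′ + e + f
    b′ = c′ + d′ + e
    a′ = b′ + c′ + d′

    c≈c′ : c ≈ c′
    c≈c′ = trans c≈ (+-congʳ (+-congʳ d≈))
    b≈b′ : b ≈ b′
    b≈b′ = trans b≈ (+-congʳ (+-cong c≈c′ d≈))
    a≈a′ : a ≈ a′
    a≈a′ = trans a≈ (+-cong (+-cong b≈b′ c≈c′) d≈)

    polynomial-identity :
      8 × sq R a′ ≈ boundaryForm (sq R a′) (sq R b′) (sq R c′) (sq R d′) (sq R e) (sq R f)
                  + boundaryForm (sq R b′) (sq R c′) (sq R d′) (sq R e) (sq R f) (sq R g)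
    polynomial-identity = solve 3 (λ e f g →
      let d = e :+ f :+ g; c = d :+ e :+ f; b = c :+ d :+ e; a = b :+ c :+ d in
      8 :× (a :* a) := :boundaryForm (a :* a) (b :* b) (c :* c) (d :* d) (e :* e) (f :* f)
                    :+ :boundaryForm (b :* b) (c :* c) (d :* d) (e :* e) (f :* f) (g :* g)) refl e f g

  ×-altSqSum-telescope : ∀ n (T Φ : ℤ → Carrier) → (∀ r → n × sq R (T r) ≈ Φ r + Φ (r -ℤ + 1)) →
    ∀ k → n × altSqSum R T k ≈ Φ -[1+ 0 ] + sgn R k * Φ (+ k)
  ×-altSqSum-telescope n T Φ step ℕ.zero = begin
    n × (1# * sq R (T (+ 0)))       ≈⟨ ×-congʳ n (*-identityˡ _) ⟩
    n × sq R (T (+ 0))              ≈⟨ step (+ 0) ⟩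
    Φ (+ 0) + Φ -[1+ 0 ]            ≈⟨ +-comm _ _ ⟩
    Φ -[1+ 0 ] + Φ (+ 0)            ≈⟨ +-congˡ (*-identityˡ _) ⟨
    Φ -[1+ 0 ] + 1# * Φ (+ 0)       ∎
  ×-altSqSum-telescope n T Φ step (ℕ.suc k) = begin
    n × (S + - s * x)                             ≈⟨ ×-distrib-+ S (- s * x) n ⟩
    n × S + n × (- s * x)                         ≈⟨ +-congˡ (×-comm-* n (- s) x) ⟨
    n × S + - s * (n × x)                         ≈⟨ +-cong (×-altSqSum-telescope n T Φ step k) (*-congˡ (step (+ ℕ.suc k))) ⟩
    (Φ₋₁ + s * Φ (+ k)) + - s * (Φ (+ ℕ.suc k) + Φ (+ ℕ.suc k -ℤ + 1))
                                                  -- + suc k -ℤ + 1 computes to suc k ⊖ 1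
                                                  ≡⟨ ≡.cong (λ i → (Φ₋₁ + s * Φ (+ k)) + - s * (Φ (+ ℕ.suc k) + Φ i))
                                                            (ℤ.[1+m]⊖[1+n]≡m⊖n k 0) ⟩
    (Φ₋₁ + s * Φ (+ k)) + - s * (Φ (+ ℕ.suc k) + Φ (+ k))
                                                  ≈⟨ solve 4 (λ P s Q U → (P :+ s :* Q) :+ (:- s) :* (U :+ Q) := P :+ (:- s) :* U)
                                                           refl Φ₋₁ s (Φ (+ k)) (Φ (+ ℕ.suc k)) ⟩
    Φ₋₁ + - s * Φ (+ ℕ.suc k)                     ∎
    where
    S s x Φ₋₁ : Carrier
    S = altSqSum R T k
    s = sgn R k
    x = sq R (T (+ ℕ.suc k))
    Φ₋₁ = Φ -[1+ 0 ]

  boundary : (ℤ → Carrier) → ℤ → Carrier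
  boundary T r = boundaryForm (sq R (T r)) (sq R (T (r -ℤ + 1))) (sq R (T (r -ℤ + 2)))
                              (sq R (T (r -ℤ + 3))) (sq R (T (r -ℤ + 4))) (sq R (T (r -ℤ + 5)))

  module _ {T : ℤ → Carrier} (isTribonacci : IsTribonacci R T) where

    isTribonacci-shifted : ∀ r i →
      T (r -ℤ + i) ≈ T (r -ℤ + (i ℕ.+ 1)) + T (r -ℤ + (i ℕ.+ 2)) + T (r -ℤ + (i ℕ.+ 3))
    isTribonacci-shifted r i = trans (isTribonacci (r -ℤ + i)) (+-cong (+-cong (shift 1) (shift 2)) (shift 3))
      where
      shift : ∀ j → T (r -ℤ + i -ℤ + j) ≈ T (r -ℤ + (i ℕ.+ j))
      shift j = reflexive (≡.cong T (i-m-n≡i-[m+n] r i j))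

    8×sq≈boundary-sum : ∀ r → 8 × sq R (T r) ≈ boundary T r + boundary T (r -ℤ + 1)
    8×sq≈boundary-sum r =
      trans (8×sq≈boundaryForm-sum (isTribonacci r)
               (isTribonacci-shifted r 1) (isTribonacci-shifted r 2) (isTribonacci-shifted r 3))
            (+-congˡ (boundaryForm-cong refl (shift 1) (shift 2) (shift 3) (shift 4) (shift 5)))
      where
      shift : ∀ j → sq R (T (r -ℤ + (1 ℕ.+ j))) ≈ sq R (T (r -ℤ + 1 -ℤ + j))
      shift j = sq-cong (reflexive (≡.cong T (≡.sym (i-m-n≡i-[m+n] r 1 j))))

mainTheorem4 : ∀ {c ℓ} (R : CommutativeRing c ℓ) → let open CommutativeRing R in
    (T : ℤ → Carrier) → IsTribonacci R T → (k : ℕ) →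
      nmul R 8 (altSqSum R T k) ≈
        ((((nmul R 7 (sq R (T -[1+ 0 ]) + sgn R k * sq R (T (+ k)))
        - nmul R 5 (sq R (T -[1+ 1 ]) + sgn R k * sq R (T (+ k -ℤ + 1))))
        + nmul R 8 (sq R (T -[1+ 2 ]) + sgn R k * sq R (T (+ k -ℤ + 2))))
        - nmul R 2 (sq R (T -[1+ 3 ]) + sgn R k * sq R (T (+ k -ℤ + 3))))
        + (sq R (T -[1+ 4 ]) + sgn R k * sq R (T (+ k -ℤ + 4))))
        - (sq R (T -[1+ 5 ]) + sgn R k * sq R (T (+ k -ℤ + 5)))
mainTheorem4 R T isTribonacci k =
  trans (×-altSqSum-telescope R 8 T (boundary R T) (8×sq≈boundary-sum R isTribonacci) k)
        (boundaryForm-linear R _ _ _ _ _ _ _ _ _ _ _ _ _)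
  where open CommutativeRing R using (trans)
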